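{- Let $G$ be a graph on $n$ nodes, let $k \in \left\{\left\lfloor \frac{n-1}{2}\right\rfloor, \ldots, n-2\right\}$ be an integer, let $\mathcal{L}$ be a left partial layout of $G$ with respect to bandwidth $k$, let $V' := V(G) \setminus \operatorname{im}(\mathcal{L})$, and for $0 \le j < n-k-1$ let \[A_j := \{v \in V' : \{\mathcal{L}(i), v\} \notin E(G) \text{ for all } 0 \le i \le j\}.\] For each $v \in V'$ let $b(v)$ be the minimum index $i \in \{0,\ldots,n-k-2\}$ with $\{\mathcal{L}(i), v\} \in E(G)$, or $b(v) = \infty$ if no such $i$ exists. Let $(w_0, w_1, \ldots, w_k)$ be an enumeration of the $k+1$ nodes of $V'$ sorted in (weakly) increasing order of $b$. Suppose $|A_j| \ge n-k-j-1$ for all $0 \le j < n-k-1$. Then the map $\mathcal{R}$ defined by $\mathcal{R}(k+j+1) := w_{2k-n+j+2}$ for $0 \le j < n-k-1$ is a right partial layout compatible with $\mathcal{L}$, and $(\mathcal{L}, \mathcal{R})$ is feasible with respect to bandwidth $k$.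
   Context: Graphs are unweighted, undirected, finite, with no self-loops. A layout of a graph $G$ on $n$ nodes is a bijection $\pi : V(G) \to \{0,1,\ldots,n-1\}$; the layout bandwidth $\beta_\pi(G)$ is the minimum non-negative integer $k$ such that $|\pi(u)-\pi(v)| \le k$ for every edge $\{u,v\}$. For $\left\lfloor \frac{n-1}{2}\right\rfloor \le k \le n-2$: a left partial layout (w.r.t. bandwidth $k$) is an injective map $\mathcal{L} : \{0,1,\ldots,n-k-2\} \to V(G)$; a right partial layout (w.r.t. bandwidth $k$) is an injective map $\mathcal{R} : \{k+1,\ldots,n-1\} \to V(G)$. $\mathcal{L}$ and $\mathcal{R}$ are compatible if $\operatorname{im}(\mathcal{L}) \cap \operatorname{im}(\mathcal{R}) = \emptyset$, equivalently if there is a layout $\pi$ with $\pi^{ -1}$ agreeing with $\mathcal{L}$ and $\mathcal{R}$ on their domains (such $\pi$ induces $\mathcal{L}$ and $\mathcal{R}$). A compatible pair $(\mathcal{L}, \mathcal{R})$ is feasible if $\beta_\pi(G) \le k$ for every layout $\pi$ inducing $\mathcal{L}$ and $\mathcal{R}$. -}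

module Defs where

open import Data.Nat.Base using (ℕ; zero; suc; _+_; _∸_; _≤_; _<_; s≤s; ∣_-_∣)
open import Data.Nat.Properties hiding (_≟_)
open import Data.Fin.Base using (Fin; toℕ; fromℕ<)
open import Data.Fin.Properties using (_≟_; toℕ<n)
open import Data.Bool.Base using (Bool; true; false; not; _∧_; if_then_else_)
open import Data.List.Base using (List; allFin; map)
open import Data.Bool.ListAction using (any; all)
open import Data.Nat.ListAction using (sum)
open import Data.Product.Base using (∃; _×_; _,_)
open import Relation.Nullary.Decidable.Core using (isYes)
open import Relation.Binary.PropositionalEquality using (_≡_; _≢_)
open import Function.Definitions using (Injective; Bijective)

record Graph (n : ℕ) : Set where
  field
    adj    : Fin n → Fin n → Bool
    adj-sym    : ∀ u v → adj u v ≡ adj v u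
    adj-irrefl : ∀ v → adj v v ≡ false
open Graph public

Edge : ∀ {n} → Graph n → Fin n → Fin n → Set
Edge G u v = adj G u v ≡ true

count : ∀ {n} → (Fin n → Bool) → ℕ
count {n} p = sum (map (λ v → if p v then 1 else 0) (allFin n))

record Layout (n : ℕ) : Set where
  field
    pos     : Fin n → Fin n
    pos-bij : Bijective _≡_ _≡_ pos
open Layout public

BandwidthAtMost : ∀ {n} → Graph n → Layout n → ℕ → Set
BandwidthAtMost G π k = ∀ u v → Edge G u v → ∣ toℕ (pos π u) - toℕ (pos π v) ∣ ≤ k

-- Size of the domains of partial layouts w.r.t. bandwidth k: n - k - 1
-- (domain {0,…,n-k-2} for left, {k+1,…,n-1} for right; index j ↦ position k+1+j).
dom : ℕ → ℕ → ℕ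
dom n k = n ∸ suc k

record LeftPartial (n k : ℕ) : Set where
  field
    L     : Fin (dom n k) → Fin n
    L-inj : Injective _≡_ _≡_ L
open LeftPartial public

-- Right partial layout, given as j ↦ ℛ(k+1+j): an injective map {k+1,…,n-1} → V(G)
IsRightPartial : (n k : ℕ) → (Fin (dom n k) → Fin n) → Set
IsRightPartial n k R = Injective _≡_ _≡_ R

Compatible : ∀ {n k} → LeftPartial n k → (Fin (dom n k) → Fin n) → Set
Compatible ℒ R = ∀ i j → L ℒ i ≢ R j

Induces : ∀ {n k} → Layout n → LeftPartial n k → (Fin (dom n k) → Fin n) → Set
Induces {n} {k} π ℒ R =
  (∀ i → toℕ (pos π (L ℒ i)) ≡ toℕ i) × (∀ j → toℕ (pos π (R j)) ≡ suc (k + toℕ j))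

Feasible : ∀ {n k} → Graph n → LeftPartial n k → (Fin (dom n k) → Fin n) → Set
Feasible {n} {k} G ℒ R = ∀ (π : Layout n) → Induces π ℒ R → BandwidthAtMost G π k

inImL : ∀ {n k} → LeftPartial n k → Fin n → Bool
inImL {n} {k} ℒ v = any (λ i → isYes (L ℒ i ≟ v)) (allFin (dom n k))

inA : ∀ {n k} → Graph n → LeftPartial n k → Fin (dom n k) → Fin n → Bool
inA {n} {k} G ℒ j v =
  not (inImL ℒ v) ∧ all (λ i → if isYes (toℕ i ≤? toℕ j) then not (adj G (L ℒ i) v) else true) (allFin (dom n k))

firstTrue : (m : ℕ) → (Fin m → Bool) → ℕ
firstTrue zero p = zero
firstTrue (suc m) p = if p Fin.zero then zero else suc (firstTrue m (λ i → p (Fin.suc i)))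
  where import Data.Fin.Base as Fin

-- b(v): least i ∈ {0,…,n-k-2} with {ℒ(i), v} ∈ E(G); the value n-k-1 encodes ∞
b : ∀ {n k} → Graph n → LeftPartial n k → Fin n → ℕ
b {n} {k} G ℒ v = firstTrue (dom n k) (λ i → adj G (L ℒ i) v)

-- index 2k-n+j+2 ∈ {0,…,k} for j < n-k-1, written (k+1)+(k+1+j) ∸ n
private
  add<-lemma : ∀ a n j → j < n ∸ a → a + j < n
  add<-lemma zero n j p = p
  add<-lemma (suc a) zero j ()
  add<-lemma (suc a) (suc n) j p = s≤s (add<-lemma a n j p)

rIdx-lemma : ∀ n k j → j < dom n k → (suc k + (suc k + j)) ∸ n < suc k
rIdx-lemma n k j j<d = s≤s (begin
    (suc k + (suc k + j)) ∸ n               ≤⟨ ∸-monoʳ-≤ (suc k + (suc k + j)) (add<-lemma (suc k) n j j<d) ⟩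
    (k + (suc k + j)) ∸ (suc k + j)         ≡⟨ m+n∸n≡m k (suc k + j) ⟩
    k ∎)
  where open ≤-Reasoning

rIdx : ∀ n k → Fin (dom n k) → Fin (suc k)
rIdx n k j = fromℕ< (rIdx-lemma n k (toℕ j) (toℕ<n j))

{-# OPTIONS --safe #-}
module Submission where

-- Let A_j = {v ∉ im ℒ : b(v) > j}.  If w_r ∉ A_j then b(w_r) ≤ j, so by sortedness none of
-- w_0, …, w_r lies in A_j and |A_j| ≤ k − r.  For r = 2k − n + j + 2 the hypothesis
-- |A_j| ≥ n − k − j − 1 = k + 1 − r excludes this, hence ℛ(k+1+j) = w_r ∈ A_j.  In a layout
-- inducing (ℒ, ℛ) an edge longer than k must join some ℒ(i) to some ℛ(k+1+j) with i ≤ j,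
-- which is exactly what ℛ(k+1+j) ∈ A_j forbids.

open import Defs
open import Data.Nat.Base using (ℕ; zero; suc; _+_; _∸_; _≤_; _<_; z≤n; s≤s; ⌊_/2⌋)
open import Data.Nat.Properties
open import Data.Fin.Base using (Fin; toℕ; fromℕ<)
open import Data.Fin.Properties using (toℕ<n; toℕ-injective; toℕ-fromℕ<; fromℕ<-injective; injective⇒≤)
import Data.Fin.Base as Fin
import Data.Fin.Properties as Fin
open import Data.Bool.Base using (Bool; true; false; not; if_then_else_)
open import Data.Bool.Properties using (T-≡; ∧-conicalˡ; ∧-conicalʳ; not-injective; not-¬)
open import Data.Bool.ListAction using (all)
open import Data.Nat.ListAction using (sum)
open import Data.List.Base using (_∷_; allFin)
open import Data.List.Properties using (map-tabulate)
open import Data.List.Membership.Propositional using (_∈_)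
open import Data.List.Membership.Propositional.Properties using (∈-allFin)
import Data.List.Relation.Unary.All as All
import Data.List.Relation.Unary.Any as Any
open import Data.List.Relation.Unary.All.Properties using (all⁺)
open import Data.List.Relation.Unary.Any.Properties using (any⁺)
open import Data.Product.Base using (Σ; ∃; _×_; _,_; proj₁; proj₂)
open import Data.Sum.Base using (inj₁; inj₂)
open import Function.Base using (_∘_)
open import Function.Bundles using (Equivalence)
open import Function.Definitions using (Injective)
open import Relation.Nullary using (¬_; yes; no; contradiction)
open import Relation.Nullary.Decidable.Core using (isYes; fromWitness)
open import Relation.Binary.PropositionalEquality using (_≡_; refl; sym; trans; cong; subst; subst₂; module ≡-Reasoning)

open Equivalence using (to; from)

all-lookup : ∀ {A : Set} (p : A → Bool) {xs x} → all p xs ≡ true → x ∈ xs → p x ≡ true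
all-lookup p {xs} allp x∈xs = to T-≡ (All.lookup (all⁺ p xs (from T-≡ allp)) x∈xs)

all≡false⇒∃ : ∀ {A : Set} (p : A → Bool) xs → all p xs ≡ false → ∃ λ x → p x ≡ false
all≡false⇒∃ p (x ∷ xs) allp with p x in px
... | true  = all≡false⇒∃ p xs allp
... | false = x , px

count-suc : ∀ {n} (p : Fin (suc n) → Bool) →
            count p ≡ (if p Fin.zero then 1 else 0) + count (p ∘ Fin.suc)
count-suc p = cong (ind Fin.zero +_) (cong sum
  (trans (map-tabulate Fin.suc ind) (sym (map-tabulate (λ i → i) (ind ∘ Fin.suc)))))
  where
  ind : Fin _ → ℕ
  ind v = if p v then 1 else 0

≤count⇒injection : ∀ {n} (p : Fin n → Bool) {c} → c ≤ count p →
                   Σ (Fin c → Fin n) λ h → Injective _≡_ _≡_ h × (∀ x → p (h x) ≡ true)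
≤count⇒injection p {zero} _ = (λ ()) , (λ { {()} }) , λ ()
≤count⇒injection {zero}  p {suc c} ()
≤count⇒injection {suc n} p {suc c} c<count
  with p Fin.zero in p0 | subst (suc c ≤_) (count-suc p) c<count
... | false | c≤rest with ≤count⇒injection (p ∘ Fin.suc) c≤rest
...   | h , h-inj , ph = Fin.suc ∘ h , h-inj ∘ Fin.suc-injective , ph
≤count⇒injection {suc n} p {suc c} c<count | true | s≤s c≤rest
  with ≤count⇒injection (p ∘ Fin.suc) c≤rest
...   | h , h-inj , ph = h′ , h′-inj , ph′
  where
  h′ : Fin (suc c) → Fin (suc n)
  h′ Fin.zero    = Fin.zero
  h′ (Fin.suc x) = Fin.suc (h x)
  h′-inj : Injective _≡_ _≡_ h′
  h′-inj {Fin.zero}  {Fin.zero}  _  = refl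
  h′-inj {Fin.suc x} {Fin.suc y} eq = cong Fin.suc (h-inj (Fin.suc-injective eq))
  ph′ : ∀ x → p (h′ x) ≡ true
  ph′ Fin.zero    = p0
  ph′ (Fin.suc x) = ph x

injective-above⇒≤ : ∀ {c m} r (f : Fin c → Fin m) → Injective _≡_ _≡_ f →
                    (∀ x → r < toℕ (f x)) → c ≤ m ∸ suc r
injective-above⇒≤ {c} {m} r f f-inj r<f = injective⇒≤ shift-inj
  where
  shifted< : ∀ x → toℕ (f x) ∸ suc r < m ∸ suc r
  shifted< x = ∸-monoˡ-< (toℕ<n (f x)) (r<f x)
  shift : Fin c → Fin (m ∸ suc r)
  shift x = fromℕ< (shifted< x)
  shift-inj : Injective _≡_ _≡_ shift
  shift-inj {x} {y} = f-inj ∘ toℕ-injective ∘ ∸-cancelʳ-≡ (r<f x) (r<f y)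
                    ∘ fromℕ<-injective _ _ (shifted< x) (shifted< y)

count≤-above : ∀ {n m} (p : Fin n → Bool) (w : Fin m → Fin n) r →
               (∀ v → p v ≡ true → ∃ λ i → r < toℕ i × w i ≡ v) → count p ≤ m ∸ suc r
count≤-above {m = m} p w r covered with ≤count⇒injection p ≤-refl
... | h , h-inj , ph = injective-above⇒≤ r index index-inj (proj₁ ∘ proj₂ ∘ covering)
  where
  covering : ∀ x → ∃ λ i → r < toℕ i × w i ≡ h x
  covering x = covered (h x) (ph x)
  index : Fin (count p) → Fin m
  index = proj₁ ∘ covering
  index-inj : Injective _≡_ _≡_ index
  index-inj {x} {y} eq = h-inj (trans (sym (proj₂ (proj₂ (covering x))))
                                  (trans (cong w eq) (proj₂ (proj₂ (covering y)))))

firstTrue≤ : ∀ {m} (p : Fin m → Bool) {i} → p i ≡ true → firstTrue m p ≤ toℕ i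
firstTrue≤ p {Fin.zero} pi rewrite pi = z≤n
firstTrue≤ p {Fin.suc i} pi with p Fin.zero
... | true  = z≤n
... | false = s≤s (firstTrue≤ (p ∘ Fin.suc) pi)

firstTrue-witness : ∀ {m} (p : Fin m → Bool) → firstTrue m p < m →
                    ∃ λ i → toℕ i ≡ firstTrue m p × p i ≡ true
firstTrue-witness {suc m} p found with p Fin.zero in p0
... | true  = Fin.zero , refl , p0
... | false with firstTrue-witness (p ∘ Fin.suc) (≤-pred found)
...   | i , i≡first , pi = Fin.suc i , cong suc i≡first , pi

m≤1+⌊m/2⌋+⌊m/2⌋ : ∀ m → m ≤ suc (⌊ m /2⌋ + ⌊ m /2⌋)
m≤1+⌊m/2⌋+⌊m/2⌋ zero             = z≤n
m≤1+⌊m/2⌋+⌊m/2⌋ (suc zero)       = s≤s z≤n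
m≤1+⌊m/2⌋+⌊m/2⌋ (suc (suc m))
  rewrite +-suc ⌊ m /2⌋ ⌊ m /2⌋ = s≤s (s≤s (m≤1+⌊m/2⌋+⌊m/2⌋ m))

⌊n∸1/2⌋≤k⇒n≤[1+k]+[1+k] : ∀ n {k} → ⌊ n ∸ 1 /2⌋ ≤ k → n ≤ suc k + suc k
⌊n∸1/2⌋≤k⇒n≤[1+k]+[1+k] zero    _ = z≤n
⌊n∸1/2⌋≤k⇒n≤[1+k]+[1+k] (suc n) {k} ⌊n/2⌋≤k = begin
  suc n                          ≤⟨ s≤s (m≤1+⌊m/2⌋+⌊m/2⌋ n) ⟩
  suc (suc (⌊ n /2⌋ + ⌊ n /2⌋))  ≤⟨ s≤s (s≤s (+-mono-≤ ⌊n/2⌋≤k ⌊n/2⌋≤k)) ⟩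
  suc (suc (k + k))              ≡⟨ cong suc (sym (+-suc k k)) ⟩
  suc k + suc k                  ∎
  where open ≤-Reasoning

m∸[m+[m+o]∸[m+n]]≡n∸o : ∀ {m n} o → n ≤ m → m ∸ ((m + (m + o)) ∸ (m + n)) ≡ n ∸ o
m∸[m+[m+o]∸[m+n]]≡n∸o {m} {n} o n≤m = begin
  m ∸ ((m + (m + o)) ∸ (m + n))  ≡⟨ cong (m ∸_) ([m+n]∸[m+o]≡n∸o m (m + o) n) ⟩
  m ∸ ((m + o) ∸ n)              ≡⟨ cong (m ∸_) (+-∸-comm o n≤m) ⟩
  m ∸ ((m ∸ n) + o)              ≡⟨ sym (∸-+-assoc m (m ∸ n) o) ⟩
  (m ∸ (m ∸ n)) ∸ o              ≡⟨ cong (_∸ o) (m∸[m∸n]≡n n≤m) ⟩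
  n ∸ o                          ∎
  where open ≡-Reasoning

dom∸≡suc∸rIdx : ∀ {n k} → n ≤ suc k + suc k → (j : Fin (dom n k)) →
                dom n k ∸ toℕ j ≡ suc k ∸ toℕ (rIdx n k j)
dom∸≡suc∸rIdx {n} {k} n≤2K j = begin
  (n ∸ K) ∸ toℕ j                              ≡⟨ m∸[m+[m+o]∸[m+n]]≡n∸o (toℕ j) (m≤n+o⇒m∸n≤o n K n≤2K) ⟨
  K ∸ ((K + (K + toℕ j)) ∸ (K + (n ∸ K)))      ≡⟨ cong (λ m → K ∸ ((K + (K + toℕ j)) ∸ m)) (m+[n∸m]≡n K≤n) ⟩
  K ∸ ((K + (K + toℕ j)) ∸ n)                  ≡⟨ cong (K ∸_) (toℕ-fromℕ< (rIdx-lemma n k (toℕ j) (toℕ<n j))) ⟨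
  K ∸ toℕ (rIdx n k j)                         ∎
  where
  open ≡-Reasoning
  K = suc k
  K≤n : K ≤ n
  K≤n = <⇒≤ (m∸n≢0⇒n<m (λ dom≡0 → n≮0 (subst (toℕ j <_) dom≡0 (toℕ<n j))))

rIdx-injective : ∀ {n k} → n ≤ suc k + suc k → Injective _≡_ _≡_ (rIdx n k)
rIdx-injective {n} {k} n≤2K {i} {j} eq =
  toℕ-injective (∸-cancelˡ-≡ (<⇒≤ (toℕ<n i)) (<⇒≤ (toℕ<n j)) (begin
    dom n k ∸ toℕ i            ≡⟨ dom∸≡suc∸rIdx n≤2K i ⟩
    suc k ∸ toℕ (rIdx n k i)   ≡⟨ cong (λ r → suc k ∸ toℕ r) eq ⟩
    suc k ∸ toℕ (rIdx n k j)   ≡⟨ dom∸≡suc∸rIdx n≤2K j ⟨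
    dom n k ∸ toℕ j            ∎))
  where open ≡-Reasoning

module _ {n k} (G : Graph n) (ℒ : LeftPartial n k) where

  inImL-L : ∀ i → inImL ℒ (L ℒ i) ≡ true
  inImL-L i = to T-≡ (any⁺ _ (Any.map (λ { refl → fromWitness refl }) (∈-allFin i)))

  inA⇒∉imL : ∀ {j v} → inA G ℒ j v ≡ true → inImL ℒ v ≡ false
  inA⇒∉imL v∈A = not-injective (∧-conicalˡ _ _ v∈A)

  inA⇒¬Edge : ∀ {j v i} → inA G ℒ j v ≡ true → toℕ i ≤ toℕ j → ¬ Edge G (L ℒ i) v
  inA⇒¬Edge {j} {v} {i} v∈A i≤j
    with toℕ i ≤? toℕ j
       | all-lookup (λ i′ → if isYes (toℕ i′ ≤? toℕ j) then not (adj G (L ℒ i′) v) else true)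
                    (∧-conicalʳ _ _ v∈A) (∈-allFin i)
  ... | yes _   | nonadjacent = λ edge → not-¬ edge (not-injective nonadjacent)
  ... | no i≰j  | _           = contradiction i≤j i≰j

  b≤⇒∉A : ∀ {j v} → b G ℒ v ≤ toℕ j → inA G ℒ j v ≡ false
  b≤⇒∉A {j} {v} b≤j
    with inA G ℒ j v in v∈A
       | firstTrue-witness (λ i → adj G (L ℒ i) v) (≤-<-trans b≤j (toℕ<n j))
  ... | false | _ = refl
  ... | true  | i , i≡b , edge = contradiction edge (inA⇒¬Edge v∈A (subst (_≤ toℕ j) (sym i≡b) b≤j))

  ∉A⇒b≤ : ∀ {j v} → inImL ℒ v ≡ false → inA G ℒ j v ≡ false → b G ℒ v ≤ toℕ j
  ∉A⇒b≤ {j} {v} v∉L v∉A rewrite v∉L with all≡false⇒∃ _ (allFin (dom n k)) v∉A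
  ... | i , i-witness with toℕ i ≤? toℕ j | i-witness
  ...   | yes i≤j | adjacent = ≤-trans (firstTrue≤ _ (not-injective adjacent)) i≤j
  ...   | no _    | ()

  ∉imL⇒compatible : ∀ {R} → (∀ j → inImL ℒ (R j) ≡ false) → Compatible ℒ R
  ∉imL⇒compatible R∉L i j Li≡Rj =
    not-¬ (inImL-L i) (subst (λ v → inImL ℒ v ≡ false) (sym Li≡Rj) (R∉L j))

  module _ {R : Fin (dom n k) → Fin n} (R∈A : ∀ j → inA G ℒ j (R j) ≡ true)
           (π : Layout n) (induces : Induces π ℒ R) where

    no-long-edge : ∀ {u v} → Edge G u v → ¬ (toℕ (pos π u) + suc k ≤ toℕ (pos π v))
    no-long-edge {u} {v} edge pu+K≤pv =
      inA⇒¬Edge (R∈A j) i≤j (subst₂ (Edge G) (sym Li≡u) (sym Rj≡v) edge)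
      where
      pu = toℕ (pos π u)
      pv = toℕ (pos π v)
      pu<d : pu < dom n k
      pu<d = m+n≤o⇒m≤o∸n (suc pu) (≤-<-trans pu+K≤pv (toℕ<n (pos π v)))
      K≤pv : suc k ≤ pv
      K≤pv = m+n≤o⇒n≤o pu pu+K≤pv
      pv∸K<d : pv ∸ suc k < dom n k
      pv∸K<d = ∸-monoˡ-< (toℕ<n (pos π v)) K≤pv
      i = fromℕ< pu<d
      j = fromℕ< pv∸K<d
      i≤j : toℕ i ≤ toℕ j
      i≤j = subst₂ _≤_ (sym (toℕ-fromℕ< pu<d)) (sym (toℕ-fromℕ< pv∸K<d)) (m+n≤o⇒m≤o∸n pu pu+K≤pv)
      Li≡u : L ℒ i ≡ u
      Li≡u = proj₁ (pos-bij π) (toℕ-injective (trans (proj₁ induces i) (toℕ-fromℕ< pu<d)))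
      Rj≡v : R j ≡ v
      Rj≡v = proj₁ (pos-bij π) (toℕ-injective (trans (proj₂ induces j)
               (trans (cong (λ x → suc (k + x)) (toℕ-fromℕ< pv∸K<d)) (m+[n∸m]≡n K≤pv))))

    ordered-edge-short : ∀ {u v} → Edge G u v → toℕ (pos π u) ≤ toℕ (pos π v) →
                         toℕ (pos π v) ∸ toℕ (pos π u) ≤ k
    ordered-edge-short edge pu≤pv = ≮⇒≥ λ k<pv∸pu →
      no-long-edge edge (subst (_ + suc k ≤_) (m+[n∸m]≡n pu≤pv) (+-monoʳ-≤ _ k<pv∸pu))

    bandwidth≤ : BandwidthAtMost G π k
    bandwidth≤ u v edge with ≤-total (toℕ (pos π u)) (toℕ (pos π v))
    ... | inj₁ pu≤pv rewrite m≤n⇒∣m-n∣≡n∸m pu≤pv = ordered-edge-short edge pu≤pv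
    ... | inj₂ pv≤pu rewrite m≤n⇒∣n-m∣≡n∸m pv≤pu = ordered-edge-short (trans (adj-sym G v u) edge) pv≤pu

  inA⇒feasible : ∀ {R} → (∀ j → inA G ℒ j (R j) ≡ true) → Feasible G ℒ R
  inA⇒feasible = bandwidth≤

  module _ (w : Fin (suc k) → Fin n)
           (w-∉imL : ∀ i → inImL ℒ (w i) ≡ false)
           (w-onto : ∀ v → inImL ℒ v ≡ false → ∃ λ i → w i ≡ v)
           (w-sorted : ∀ i i′ → toℕ i ≤ toℕ i′ → b G ℒ (w i) ≤ b G ℒ (w i′)) where

    sorted⇒inA : ∀ j r → suc k ∸ toℕ r ≤ count (inA G ℒ j) → inA G ℒ j (w r) ≡ true
    sorted⇒inA j r A-large with inA G ℒ j (w r) in wr-inA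
    ... | true  = refl
    ... | false = contradiction (≤-trans A-large A-small)
                                (<⇒≱ (∸-monoˡ-< (n<1+n k) (≤-pred (toℕ<n r))))
      where
      b[wr]≤j : b G ℒ (w r) ≤ toℕ j
      b[wr]≤j = ∉A⇒b≤ (w-∉imL r) wr-inA
      A-above-r : ∀ v → inA G ℒ j v ≡ true → ∃ λ i → toℕ r < toℕ i × w i ≡ v
      A-above-r v v∈A with w-onto v (inA⇒∉imL v∈A)
      ... | i , refl = i , ≰⇒> (λ i≤r → not-¬ v∈A (b≤⇒∉A (≤-trans (w-sorted i r i≤r) b[wr]≤j))) , refl
      A-small : count (inA G ℒ j) ≤ k ∸ toℕ r
      A-small = count≤-above (inA G ℒ j) w (toℕ r) A-above-r

proposition4p1 :
    ∀ (n : ℕ) (G : Graph n) (k : ℕ) →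
    ⌊ n ∸ 1 /2⌋ ≤ k → k + 2 ≤ n →
    (ℒ : LeftPartial n k) →
    (w : Fin (suc k) → Fin n) →
    Injective _≡_ _≡_ w →
    (∀ i → inImL ℒ (w i) ≡ false) →
    (∀ v → inImL ℒ v ≡ false → ∃ λ i → w i ≡ v) →
    (∀ i i′ → toℕ i ≤ toℕ i′ → b G ℒ (w i) ≤ b G ℒ (w i′)) →
    (∀ (j : Fin (dom n k)) → dom n k ∸ toℕ j ≤ count (inA G ℒ j)) →
    IsRightPartial n k (λ j → w (rIdx n k j))
      × Compatible ℒ (λ j → w (rIdx n k j))
      × Feasible G ℒ (λ j → w (rIdx n k j))
proposition4p1 n G k ⌊n∸1/2⌋≤k _ ℒ w w-inj w-∉imL w-onto w-sorted A-large =
  rIdx-injective n≤2K ∘ w-inj ,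
  ∉imL⇒compatible G ℒ (w-∉imL ∘ rIdx n k) ,
  inA⇒feasible G ℒ R∈A
  where
  n≤2K : n ≤ suc k + suc k
  n≤2K = ⌊n∸1/2⌋≤k⇒n≤[1+k]+[1+k] n ⌊n∸1/2⌋≤k
  R∈A : ∀ j → inA G ℒ j (w (rIdx n k j)) ≡ true
  R∈A j = sorted⇒inA G ℒ w w-∉imL w-onto w-sorted j (rIdx n k j)
            (subst (_≤ count (inA G ℒ j)) (dom∸≡suc∸rIdx n≤2K j) (A-large j))
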